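{- Let $n\in\mathbb{N}$. Every connected component of the crystal graph $\Gamma(\mathrm{plac}_n)$ contains at most one connected component of the quasi-crystal graph $\Gamma_n$ consisting of quasi-ribbon words.
   Context: $\mathcal{A}_n=\{1<\dots<n\}$. Kashiwara operators $\tilde e_i,\tilde f_i$ ($i=1,\dots,n-1$): replace each letter $i$ of $u$ by $+$, each $i+1$ by $-$, delete other letters, and repeatedly delete factors $-+$ until $+^p-^q$ remains; if $q>0$, $\tilde e_i(u)$ changes the letter $i+1$ corresponding to the leftmost remaining $-$ into $i$ (else undefined); if $p>0$, $\tilde f_i(u)$ changes the letter $i$ corresponding to the rightmost remaining $+$ into $i+1$ (else undefined). The crystal graph $\Gamma(\mathrm{plac}_n)$ has vertex set $\mathcal{A}_n^*$ and edges $u\to\tilde f_i(u)$ labelled $i$. A word $u$ has an $i$-inversion if it contains a letter $i+1$ left of a letter $i$. Quasi-Kashiwara operators: if $u$ has an $i$-inversion, $e_i(u),f_i(u)$ are undefined; otherwise $e_i(u)$ replaces the leftmost $i+1$ by $i$ (undefined if none), $f_i(u)$ replaces the rightmost $i$ by $i+1$ (undefined if none). The quasi-crystal graph $\Gamma_n$ has vertex set $\mathcal{A}_n^*$ and edges $u\to f_i(u)$ labelled $i$; each component of $\Gamma_n$ lies inside a component of $\Gamma(\mathrm{plac}_n)$. A ribbon diagram of shape a composition $(\alpha_1,\dots,\alpha_k)$ has $\alpha_h$ boxes in row $h$, leftmost box of each row directly below the rightmost box of the previous row. A quasi-ribbon tableau is such a diagram filled with positive integers, rows weakly increasing left to right,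 columns strictly increasing top to bottom. A quasi-ribbon word is the column reading (columns left to right, each bottom to top) of a quasi-ribbon tableau. -}

module Defs where

open import Data.Nat using (ℕ; zero; suc; _≤_; _<_; _≡ᵇ_)
open import Data.Bool using (Bool; true; false; _∧_; _∨_; if_then_else_)
open import Data.List using (List; []; _∷_; _++_; [_]; reverse; concatMap; foldl)
open import Data.Bool.ListAction using (any)
open import Data.List.Relation.Unary.All using (All)
open import Data.List.Relation.Unary.Linked using (Linked)
open import Data.Maybe using (Maybe; just; nothing)
open import Data.Product using (_×_; _,_; Σ; ∃; ∃-syntax)
open import Relation.Binary.PropositionalEquality using (_≡_)
open import Relation.Binary.Construct.Closure.Equivalence using (EqClosure)

Word : Set
Word = List ℕ

InAlph : ℕ → Word → Set
InAlph n u = All (λ a → 1 ≤ a × a ≤ n) u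

-- replace the letter at position p (0-based) by b
setAt : Word → ℕ → ℕ → Word
setAt []      _       _ = []
setAt (a ∷ w) zero    b = b ∷ w
setAt (a ∷ w) (suc p) b = a ∷ setAt w p b

data Sign : Set where
  plus minus : Sign

signsFrom : ℕ → ℕ → Word → List (Sign × ℕ)
signsFrom i p [] = []
signsFrom i p (a ∷ w) =
  if a ≡ᵇ i then (plus , p) ∷ signsFrom i (suc p) w
  else if a ≡ᵇ suc i then (minus , p) ∷ signsFrom i (suc p) w
  else signsFrom i (suc p) w

-- stack step: deleting a factor "-+" whenever it appears
pushSign : List (Sign × ℕ) → Sign × ℕ → List (Sign × ℕ)
pushSign ((minus , q) ∷ st) (plus , p) = st
pushSign st x = x ∷ st

-- the reduced word +^p -^q (with positions), left to right
reduced : ℕ → Word → List (Sign × ℕ)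
reduced i u = reverse (foldl pushSign [] (signsFrom i 0 u))

leftmostMinus : List (Sign × ℕ) → Maybe ℕ
leftmostMinus [] = nothing
leftmostMinus ((minus , p) ∷ _) = just p
leftmostMinus ((plus , _) ∷ r) = leftmostMinus r

rightmostPlus : List (Sign × ℕ) → Maybe ℕ
rightmostPlus l = go (reverse l)
  where
  go : List (Sign × ℕ) → Maybe ℕ
  go [] = nothing
  go ((plus , p) ∷ _) = just p
  go ((minus , _) ∷ r) = go r

kashE : ℕ → Word → Maybe Word
kashE i u with leftmostMinus (reduced i u)
... | nothing = nothing
... | just p  = just (setAt u p i)

kashF : ℕ → Word → Maybe Word
kashF i u with rightmostPlus (reduced i u)
... | nothing = nothing
... | just p  = just (setAt u p (suc i))

CrystalEdge : ℕ → Word → Word → Set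
CrystalEdge n u v = ∃[ i ] (1 ≤ i × suc i ≤ n × InAlph n u × kashF i u ≡ just v)

CrystalConn : ℕ → Word → Word → Set
CrystalConn n = EqClosure (CrystalEdge n)

hasInv : ℕ → Word → Bool
hasInv i [] = false
hasInv i (a ∷ w) = ((a ≡ᵇ suc i) ∧ any (λ b → b ≡ᵇ i) w) ∨ hasInv i w

rightmostPos : ℕ → ℕ → Word → Maybe ℕ
rightmostPos c p [] = nothing
rightmostPos c p (a ∷ w) with rightmostPos c (suc p) w
... | just q  = just q
... | nothing = if a ≡ᵇ c then just p else nothing

leftmostPos : ℕ → ℕ → Word → Maybe ℕ
leftmostPos c p [] = nothing
leftmostPos c p (a ∷ w) = if a ≡ᵇ c then just p else leftmostPos c (suc p) w

quasiE : ℕ → Word → Maybe Word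
quasiE i u with hasInv i u | leftmostPos (suc i) 0 u
... | true  | _       = nothing
... | false | nothing = nothing
... | false | just p  = just (setAt u p i)

quasiF : ℕ → Word → Maybe Word
quasiF i u with hasInv i u | rightmostPos i 0 u
... | true  | _       = nothing
... | false | nothing = nothing
... | false | just p  = just (setAt u p (suc i))

QuasiEdge : ℕ → Word → Word → Set
QuasiEdge n u v = ∃[ i ] (1 ≤ i × suc i ≤ n × InAlph n u × quasiF i u ≡ just v)

QuasiConn : ℕ → Word → Word → Set
QuasiConn n = EqClosure (QuasiEdge n)

-- A filling of a ribbon diagram is given by its list of rows (left to right).
-- Columns are computed from the ribbon geometry: the first box of each row
-- lies directly below the last box of the previous row (same column);
-- every further box of a row starts a new column.
-- State: (finished columns, current column), columns listed top to bottom.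
placeRest : List Word → Word → Word → List Word × Word
placeRest cl op []       = cl , op
placeRest cl op (y ∷ ys) = placeRest (cl ++ [ op ]) [ y ] ys

placeRow : List Word × Word → Word → List Word × Word
placeRow (cl , op) []       = cl , op
placeRow (cl , op) (x ∷ xs) = placeRest cl (op ++ [ x ]) xs

columns : List Word → List Word
columns rows with foldl placeRow ([] , []) rows
... | cl , op = cl ++ [ op ]

data NonEmpty : Word → Set where
  nonEmpty : ∀ {a w} → NonEmpty (a ∷ w)

record QuasiRibbonTableau (rows : List Word) : Set where
  field
    rowsNonEmpty : All NonEmpty rows
    positive     : All (All (λ a → 1 ≤ a)) rows
    rowsWeak     : All (Linked _≤_) rows
    colsStrict   : All (Linked _<_) (columns rows)

columnReading : List Word → Word
columnReading rows = concatMap reverse (columns rows)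

QuasiRibbonWord : Word → Set
QuasiRibbonWord w = Σ (List Word) λ rows → QuasiRibbonTableau rows × columnReading rows ≡ w

module Submission where

-- Lowering by a quasi-Kashiwara operator e_i decreases the sum of the letters, so every
-- component of Γ_n contains a highest weight word h, on which no e_i (1 ≤ i < n) is defined:
-- whenever a letter i+1 occurs in h, some i+1 of h lies to the left of some i.  In a
-- quasi-ribbon word this forces the columns to be runs b, b+1, …, b+k of consecutive
-- letters, the first starting at 1 and each next one at the bottom entry of the previous;
-- such a word is determined by its descents (per column k descents, then an ascent).
-- Both f̃_i and f_i change a letter i into i+1 that is neither preceded by i+1 nor followed
-- by i, so they preserve descents.  Hence two components of Γ_n of quasi-ribbon words in
-- one component of Γ(plac_n) have highest weight words with the same descents, which are
-- therefore equal.

open import Defs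
open import Data.Bool using (Bool; true; false)
open import Data.Bool.ListAction using (any)
open import Data.Empty using (⊥-elim)
open import Data.List using (List; []; _∷_; _++_; [_]; _ʳ++_; concatMap; foldl; head; last; length; replicate; reverse)
open import Data.List.Membership.Propositional using (_∈_; _∉_)
open import Data.List.Membership.Propositional.Properties using (∈-++⁺ˡ; ∈-++⁺ʳ; ∈-++⁻)
open import Data.List.Properties using (reverse-involutive; ʳ++-defn; ∷-injectiveʳ)
open import Data.List.Relation.Unary.All as All using (All; []; _∷_)
open import Data.List.Relation.Unary.All.Properties using (++⁺; ++⁻)
open import Data.List.Relation.Unary.Any using (here; there)
open import Data.List.Relation.Unary.Any.Properties using (reverse⁺; reverse⁻)
open import Data.List.Relation.Unary.Linked using (Linked; []; [-]; _∷_)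
open import Data.Maybe using (Maybe; just; nothing)
open import Data.Maybe.Properties using (just-injective)
open import Data.Nat using (ℕ; zero; suc; _+_; _≤_; _<_; _≡ᵇ_; _<ᵇ_; s≤s)
open import Data.Nat.Induction using (<-wellFounded)
open import Data.Nat.ListAction using (sum)
open import Data.Nat.ListAction.Properties using (sum-++)
open import Data.Nat.Properties
  using (_≟_; _≤?_; ≤-refl; ≤-trans; ≤-<-trans; <⇒≤; <⇒≢; <⇒≱; 1+n≰n; n≤1+n; n<1+n; m≤m+n;
         m≤n⇒m<n∨m≡n; +-suc; +-identityʳ; +-monoʳ-<; <ᵇ-reflects-<; anyUpTo?)
open import Data.Product using (_×_; _,_; ∃₂; ∃-syntax; proj₁; proj₂; map₂)
open import Data.Sum as Sum using (_⊎_; inj₁; inj₂)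
open import Function using (_∘_; case_of_)
open import Induction.WellFounded using (Acc; acc)
open import Relation.Binary.Construct.Closure.Equivalence using (gfold; transitive; symmetric)
open import Relation.Binary.Construct.Closure.ReflexiveTransitive using (ε; _◅_)
open import Relation.Binary.Construct.Closure.Symmetric using (bwd)
open import Relation.Binary.PropositionalEquality
  using (_≡_; _≢_; refl; sym; trans; cong; cong₂; subst; isEquivalence)
open import Relation.Nullary using (¬_; Dec; yes; no; proof)
open import Relation.Nullary.Reflects using (Reflects; ofʸ; ofⁿ)

≡ᵇ-reflects-≡ : ∀ m n → Reflects (m ≡ n) (m ≡ᵇ n)
≡ᵇ-reflects-≡ m n = proof (m ≟ n)

m<ᵇn≡1+m<ᵇn : ∀ {m n} → n ≢ suc m → (m <ᵇ n) ≡ (suc m <ᵇ n)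
m<ᵇn≡1+m<ᵇn {zero}  {zero}        _   = refl
m<ᵇn≡1+m<ᵇn {zero}  {suc zero}    n≢1 = ⊥-elim (n≢1 refl)
m<ᵇn≡1+m<ᵇn {zero}  {suc (suc n)} _   = refl
m<ᵇn≡1+m<ᵇn {suc m} {zero}        _   = refl
m<ᵇn≡1+m<ᵇn {suc m} {suc n}       n≢  = m<ᵇn≡1+m<ᵇn (n≢ ∘ cong suc)

m<ᵇn≡m<ᵇ1+n : ∀ {m n} → m ≢ n → (m <ᵇ n) ≡ (m <ᵇ suc n)
m<ᵇn≡m<ᵇ1+n {zero}  {zero}  m≢n = ⊥-elim (m≢n refl)
m<ᵇn≡m<ᵇ1+n {zero}  {suc n} _   = refl
m<ᵇn≡m<ᵇ1+n {suc m} {zero}  _   = refl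
m<ᵇn≡m<ᵇ1+n {suc m} {suc n} m≢n = m<ᵇn≡m<ᵇ1+n (m≢n ∘ cong suc)

n<ᵇ1+n : ∀ n → (n <ᵇ suc n) ≡ true
n<ᵇ1+n zero    = refl
n<ᵇ1+n (suc n) = n<ᵇ1+n n

replicate-++-∷ : ∀ {A : Set} k (a : A) z → replicate k a ++ a ∷ z ≡ a ∷ replicate k a ++ z
replicate-++-∷ zero    a z = refl
replicate-++-∷ (suc k) a z = cong (a ∷_) (replicate-++-∷ k a z)

setAt-++ : ∀ (x : Word) a y b → setAt (x ++ a ∷ y) (length x) b ≡ x ++ b ∷ y
setAt-++ []      a y b = refl
setAt-++ (c ∷ x) a y b = cong (c ∷_) (setAt-++ x a y b)

last-∈ : ∀ {a} (x : Word) → last x ≡ just a → a ∈ x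
last-∈ (b ∷ [])    refl = here refl
last-∈ (b ∷ c ∷ x) eq   = there (last-∈ (c ∷ x) eq)

head-∈ : ∀ {a} (y : Word) → head y ≡ just a → a ∈ y
head-∈ (b ∷ y) refl = here refl

last-++-[_] : ∀ (c : Word) x → last (c ++ [ x ]) ≡ just x
last-++-[_] []          x = refl
last-++-[_] (a ∷ [])    x = refl
last-++-[_] (a ∷ b ∷ c) x = last-++-[_] (b ∷ c) x

-- Raising letters and descents

data Raise (i : ℕ) : Word → Word → Set where
  raise : ∀ x y → last x ≢ just (suc i) → head y ≢ just i →
          Raise i (x ++ i ∷ y) (x ++ suc i ∷ y)

descentAt : ℕ → Word → Bool
descentAt a []      = false
descentAt a (b ∷ _) = b <ᵇ a

descents : Word → List Bool
descents []      = []
descents (a ∷ w) = descentAt a w ∷ descents w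

descents-raise : ∀ {i u v} → Raise i u v → descents u ≡ descents v
descents-raise (raise []          []      _  _)  = refl
descents-raise (raise []          (d ∷ y) _  y≁) =
  cong (_∷ descents (d ∷ y)) (m<ᵇn≡m<ᵇ1+n (y≁ ∘ cong just))
descents-raise (raise (c ∷ [])    y       x≁ y≁) =
  cong₂ _∷_ (m<ᵇn≡1+m<ᵇn (x≁ ∘ cong just)) (descents-raise (raise [] y (λ ()) y≁))
descents-raise (raise (c ∷ d ∷ x) y       x≁ y≁) =
  cong ((d <ᵇ c) ∷_) (descents-raise (raise (d ∷ x) y x≁ y≁))

raise-increases-sum : ∀ {i u v} → Raise i u v → sum u < sum v
raise-increases-sum {i} (raise x y _ _) rewrite sum-++ x (i ∷ y) | sum-++ x (suc i ∷ y) =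
  +-monoʳ-< (sum x) (n<1+n (i + sum y))

raise-InAlph⁻ : ∀ {n i u v} → Raise i u v → 1 ≤ i → InAlph n v → InAlph n u
raise-InAlph⁻ (raise x y _ _) 1≤i v∈ with ++⁻ x v∈
... | x∈ , (_ , si≤n) ∷ y∈ = ++⁺ x∈ ((1≤i , <⇒≤ si≤n) ∷ y∈)

-- The bracketing rule

-- The stack built by pushSign holds the unbracketed signs, the rightmost one on top.
topPlus : List (Sign × ℕ) → Maybe ℕ
topPlus []                 = nothing
topPlus ((plus  , p) ∷ _)  = just p
topPlus ((minus , _) ∷ st) = topPlus st

rightmostPlus-reverse : ∀ st → rightmostPlus (reverse st) ≡ topPlus st
rightmostPlus-reverse st = go st (reverse st) (reverse-involutive st)
  where
  -- the helper of rightmostPlus is local, so it is only reached by unfolding rightmostPlus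
  go : ∀ st l → reverse l ≡ st → rightmostPlus l ≡ topPlus st
  go []                 l e rewrite e = refl
  go ((plus  , p) ∷ st) l e rewrite e = refl
  go ((minus , q) ∷ st) l e with go st (reverse st) (reverse-involutive st)
  ... | ih rewrite e | reverse-involutive st = ih

data TopMinus : List (Sign × ℕ) → Set where
  topMinus : ∀ {q st} → TopMinus ((minus , q) ∷ st)

topMinus? : ∀ st → Dec (TopMinus st)
topMinus? []                 = no λ ()
topMinus? ((plus  , _) ∷ _)  = no λ ()
topMinus? ((minus , _) ∷ _)  = yes topMinus

pushSign-minus : ∀ st q → pushSign st (minus , q) ≡ (minus , q) ∷ st
pushSign-minus []                q = refl
pushSign-minus ((plus  , _) ∷ _) q = refl
pushSign-minus ((minus , _) ∷ _) q = refl

pushSign-plus : ∀ st q → ¬ TopMinus st → pushSign st (plus , q) ≡ (plus , q) ∷ st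
pushSign-plus []                q _  = refl
pushSign-plus ((plus  , _) ∷ _) q _  = refl
pushSign-plus ((minus , _) ∷ _) q ¬t = ⊥-elim (¬t topMinus)

bracket : ℕ → List (Sign × ℕ) → ℕ → Word → List (Sign × ℕ)
bracket i st p₀ w = foldl pushSign st (signsFrom i p₀ w)

-- When x is empty, the letter preceding it has already been read into st.
NoMinusBefore : ℕ → List (Sign × ℕ) → Word → Set
NoMinusBefore i st []      = ¬ TopMinus st
NoMinusBefore i st (a ∷ x) = last (a ∷ x) ≢ just (suc i)

PlusIn : ℕ → List (Sign × ℕ) → ℕ → Word → ℕ → Set
PlusIn i st p₀ w p = ∃₂ λ x y →
  w ≡ x ++ i ∷ y × p ≡ p₀ + length x × head y ≢ just i × NoMinusBefore i st x

PlusIn-cons : ∀ {i st st′ p₀ w p} a → (NoMinusBefore i st′ [] → a ≢ suc i) →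
              PlusIn i st′ (suc p₀) w p → PlusIn i st p₀ (a ∷ w) p
PlusIn-cons {p₀ = p₀} a a≁ ([] , y , refl , refl , y≁ , x≁) =
  [ a ] , y , refl , sym (+-suc p₀ 0) , y≁ , a≁ x≁ ∘ just-injective
PlusIn-cons {p₀ = p₀} a a≁ (b ∷ x , y , refl , refl , y≁ , x≁) =
  a ∷ b ∷ x , y , refl , sym (+-suc p₀ _) , y≁ , x≁

-- A + is cancelled only on arrival, by a − on top of the stack; once pushed it stays.
-- So the topmost + of the final stack comes from a letter i that is not followed by i
-- (whose + would be pushed above it) and not preceded by i+1 (whose − would cancel it).
topPlus-bracket : ∀ i st p₀ w {p} → topPlus (bracket i st p₀ w) ≡ just p →
  (topPlus st ≡ just p × (head w ≡ just i → TopMinus st)) ⊎ PlusIn i st p₀ w p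
topPlus-bracket i st p₀ []      top = inj₁ (top , λ ())
topPlus-bracket i st p₀ (a ∷ w) top with a ≡ᵇ i | ≡ᵇ-reflects-≡ a i
... | true  | ofʸ refl with topMinus? st
...   | yes topMinus = Sum.map (map₂ λ _ _ → topMinus) (PlusIn-cons i λ _ → <⇒≢ (n<1+n i))
                         (topPlus-bracket i _ (suc p₀) w top)
...   | no ¬t rewrite pushSign-plus st p₀ ¬t
        with topPlus-bracket i ((plus , p₀) ∷ st) (suc p₀) w top
...     | inj₁ (p₀≡p , pushed) = inj₂ ([] , w , refl , sym (trans (+-identityʳ p₀) (just-injective p₀≡p)) ,
                                       (λ w≁ → case pushed w≁ of λ ()) , ¬t)
...     | inj₂ inW = inj₂ (PlusIn-cons i (λ _ → <⇒≢ (n<1+n i)) inW)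
topPlus-bracket i st p₀ (a ∷ w) top | false | ofⁿ a≢i with a ≡ᵇ suc i | ≡ᵇ-reflects-≡ a (suc i)
... | true  | ofʸ refl rewrite pushSign-minus st p₀ =
  Sum.map (map₂ λ _ → ⊥-elim ∘ a≢i ∘ just-injective) (PlusIn-cons (suc i) λ ¬t → ⊥-elim (¬t topMinus))
    (topPlus-bracket i ((minus , p₀) ∷ st) (suc p₀) w top)
... | false | ofⁿ a≢si =
  Sum.map (map₂ λ _ → ⊥-elim ∘ a≢i ∘ just-injective) (PlusIn-cons a λ _ → a≢si)
    (topPlus-bracket i st (suc p₀) w top)

kashF-raise : ∀ {i u v} → kashF i u ≡ just v → Raise i u v
kashF-raise {i} {u} f̃u≡v with rightmostPlus (reduced i u) in top
... | just p with topPlus-bracket i [] 0 u (trans (sym (rightmostPlus-reverse (bracket i [] 0 u))) top)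
...   | inj₁ (() , _)
...   | inj₂ (x , y , refl , refl , y≁ , x≁) with f̃u≡v
...     | refl rewrite setAt-++ x i y (suc i) = raise x y (last-ok x x≁) y≁
  where
  last-ok : ∀ x → NoMinusBefore i [] x → last x ≢ just (suc i)
  last-ok []      _  = λ ()
  last-ok (a ∷ x) x≁ = x≁

crystal-descents : ∀ {n u v} → CrystalConn n u v → descents u ≡ descents v
crystal-descents = gfold isEquivalence descents λ (_ , _ , _ , _ , f̃u≡v) → descents-raise (kashF-raise f̃u≡v)

-- Quasi-Kashiwara operators and highest weight words

data Inversion (i : ℕ) : Word → Set where
  here  : ∀ {w} → i ∈ w → Inversion i (suc i ∷ w)
  there : ∀ {a w} → Inversion i w → Inversion i (a ∷ w)

inversion⇒∈ : ∀ {i w} → Inversion i w → i ∈ w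
inversion⇒∈ (here i∈w) = there i∈w
inversion⇒∈ (there inv) = there (inversion⇒∈ inv)

inversion-++⁺ : ∀ {i} x {y} → i ∈ y → Inversion i (x ++ suc i ∷ y)
inversion-++⁺ []      i∈y = here i∈y
inversion-++⁺ (_ ∷ x) i∈y = there (inversion-++⁺ x i∈y)

inversion-++⁻ : ∀ {i} x {y} → suc i ∉ x → Inversion i (x ++ y) → Inversion i y
inversion-++⁻ []      _   inv         = inv
inversion-++⁻ (_ ∷ x) si∉ (here _)    = ⊥-elim (si∉ (here refl))
inversion-++⁻ (_ ∷ x) si∉ (there inv) = inversion-++⁻ x (si∉ ∘ there) inv

∈-reflects : ∀ i w → Reflects (i ∈ w) (any (λ b → b ≡ᵇ i) w)
∈-reflects i []      = ofⁿ λ ()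
∈-reflects i (a ∷ w) with a ≡ᵇ i | ≡ᵇ-reflects-≡ a i
... | true  | ofʸ refl = ofʸ (here refl)
... | false | ofⁿ a≢i with any (λ b → b ≡ᵇ i) w | ∈-reflects i w
...   | true  | ofʸ i∈w = ofʸ (there i∈w)
...   | false | ofⁿ i∉w = ofⁿ λ { (here refl) → a≢i refl ; (there i∈w) → i∉w i∈w }

hasInv-reflects : ∀ i w → Reflects (Inversion i w) (hasInv i w)
hasInv-reflects i []      = ofⁿ λ ()
hasInv-reflects i (a ∷ w)
  with a ≡ᵇ suc i | ≡ᵇ-reflects-≡ a (suc i) | any (λ b → b ≡ᵇ i) w | ∈-reflects i w
     | hasInv i w | hasInv-reflects i w
... | true  | ofʸ refl | true  | ofʸ i∈w | _     | _        = ofʸ (here i∈w)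
... | true  | ofʸ refl | false | ofⁿ i∉w | true  | ofʸ inv  = ofʸ (there inv)
... | true  | ofʸ refl | false | ofⁿ i∉w | false | ofⁿ ¬inv =
  ofⁿ λ { (here i∈w) → i∉w i∈w ; (there inv) → ¬inv inv }
... | false | ofⁿ a≢si | _     | _        | true  | ofʸ inv  = ofʸ (there inv)
... | false | ofⁿ a≢si | _     | _        | false | ofⁿ ¬inv =
  ofⁿ λ { (here _) → a≢si refl ; (there inv) → ¬inv inv }

data QuasiRaise (i : ℕ) : Word → Word → Set where
  quasiRaise : ∀ x y → suc i ∉ x → i ∉ y → QuasiRaise i (x ++ i ∷ y) (x ++ suc i ∷ y)

quasiRaise⇒raise : ∀ {i u v} → QuasiRaise i u v → Raise i u v
quasiRaise⇒raise (quasiRaise x y si∉x i∉y) = raise x y (si∉x ∘ last-∈ x) (i∉y ∘ head-∈ y)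

leftmostPos-just : ∀ c p w {q} → leftmostPos c p w ≡ just q →
  ∃₂ λ x y → w ≡ x ++ c ∷ y × q ≡ p + length x × c ∉ x
leftmostPos-just c p (a ∷ w) eq with a ≡ᵇ c | ≡ᵇ-reflects-≡ a c
... | true  | ofʸ refl = [] , w , refl , sym (trans (+-identityʳ p) (just-injective eq)) , λ ()
... | false | ofⁿ a≢c with leftmostPos-just c (suc p) w eq
...   | x , y , refl , refl , c∉x =
  a ∷ x , y , refl , sym (+-suc p _) , λ { (here refl) → a≢c refl ; (there c∈x) → c∉x c∈x }

leftmostPos-nothing : ∀ c p w → leftmostPos c p w ≡ nothing → c ∉ w
leftmostPos-nothing c p (a ∷ w) eq c∈ with a ≡ᵇ c | ≡ᵇ-reflects-≡ a c | c∈
... | true  | ofʸ _   | _         = case eq of λ ()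
... | false | ofⁿ a≢c | here refl = a≢c refl
... | false | ofⁿ _   | there c∈w = leftmostPos-nothing c (suc p) w eq c∈w

rightmostPos-nothing : ∀ c p y → c ∉ y → rightmostPos c p y ≡ nothing
rightmostPos-nothing c p []      _   = refl
rightmostPos-nothing c p (a ∷ y) c∉y rewrite rightmostPos-nothing c (suc p) y (c∉y ∘ there)
  with a ≡ᵇ c | ≡ᵇ-reflects-≡ a c
... | true  | ofʸ refl = ⊥-elim (c∉y (here refl))
... | false | ofⁿ _    = refl

rightmostPos-++ : ∀ c p x y → c ∉ y → rightmostPos c p (x ++ c ∷ y) ≡ just (p + length x)
rightmostPos-++ c p [] y c∉y rewrite rightmostPos-nothing c (suc p) y c∉y | +-identityʳ p
  with c ≡ᵇ c | ≡ᵇ-reflects-≡ c c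
... | true  | ofʸ _   = refl
... | false | ofⁿ c≢c = ⊥-elim (c≢c refl)
rightmostPos-++ c p (a ∷ x) y c∉y rewrite rightmostPos-++ c (suc p) x y c∉y | +-suc p (length x) = refl

quasiE-lower : ∀ {i u v} → quasiE i u ≡ just v → QuasiRaise i v u
quasiE-lower {i} {u} eᵢu≡v with hasInv i u | hasInv-reflects i u | leftmostPos (suc i) 0 u in pos
... | false | ofⁿ ¬inv | just p with leftmostPos-just (suc i) 0 u pos
...   | x , y , refl , refl , si∉x with eᵢu≡v
...     | refl rewrite setAt-++ x (suc i) y i =
  quasiRaise x y si∉x (¬inv ∘ inversion-++⁺ x)

quasiF-raise : ∀ {i u v} → QuasiRaise i u v → quasiF i u ≡ just v
quasiF-raise {i} (quasiRaise x y si∉x i∉y)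
  with hasInv i (x ++ i ∷ y) | hasInv-reflects i (x ++ i ∷ y)
... | true  | ofʸ inv =
  ⊥-elim (i∉y (inversion⇒∈ (drop-i (inversion-++⁻ x si∉x inv))))
  where
  drop-i : Inversion i (i ∷ y) → Inversion i y
  drop-i (there inv) = inv
... | false | ofⁿ _ rewrite rightmostPos-++ i 0 x y i∉y = cong just (setAt-++ x i y (suc i))

quasiE-nothing : ∀ {i h} → quasiE i h ≡ nothing → suc i ∈ h → Inversion i h
quasiE-nothing {i} {h} eᵢh≡∅ si∈h with hasInv i h | hasInv-reflects i h | leftmostPos (suc i) 0 h in pos
... | true  | ofʸ inv | _       = inv
... | false | ofⁿ _   | nothing = ⊥-elim (leftmostPos-nothing (suc i) 0 h pos si∈h)

Lowerable : Word → ℕ → Set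
Lowerable h i = 1 ≤ i × ∃[ v ] quasiE i h ≡ just v

lowerable? : ∀ h i → Dec (Lowerable h i)
lowerable? h i with 1 ≤? i | quasiE i h
... | no 1≰i  | _       = no (1≰i ∘ proj₁)
... | yes 1≤i | just v  = yes (1≤i , v , refl)
... | yes _   | nothing = no λ { (_ , _ , ()) }

Highest : ℕ → Word → Set
Highest n h = ¬ (∃[ i ] (i < n × Lowerable h i))

reach-highest : ∀ {n u} → InAlph n u → Acc _<_ (sum u) →
  ∃[ h ] (QuasiConn n u h × InAlph n h × descents h ≡ descents u × Highest n h)
reach-highest {n} {u} u∈ (acc smaller) with anyUpTo? (lowerable? u) n
... | no highest = u , ε , u∈ , refl , highest
... | yes (i , i<n , 1≤i , v , eᵢu≡v) =
  let lowered = quasiE-lower eᵢu≡v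
      raised  = quasiRaise⇒raise lowered
      v∈      = raise-InAlph⁻ raised 1≤i u∈
      h , v~h , h∈ , desc , highest = reach-highest v∈ (smaller (raise-increases-sum raised))
  in  h , bwd (i , 1≤i , i<n , v∈ , quasiF-raise lowered) ◅ v~h ,
      h∈ , trans desc (descents-raise raised) , highest

InversionsFrom : ℕ → Word → Set
InversionsFrom b w = ∀ {i} → b ≤ i → suc i ∈ w → Inversion i w

highest-inversions : ∀ {n h} → InAlph n h → Highest n h → InversionsFrom 1 h
highest-inversions {h = h} h∈ highest {i} 1≤i si∈h with quasiE i h in eh
... | just v  = ⊥-elim (highest (i , proj₂ (All.lookup h∈ si∈h) , 1≤i , v , eh))
... | nothing = quasiE-nothing eh si∈h

-- Columns of quasi-ribbon tableaux

reading : List Word → Word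
reading = concatMap reverse

data StrictColumn (b : ℕ) : Word → ℕ → Set where
  bottom : ∀ {e} → b ≤ e → StrictColumn b [ e ] e
  above  : ∀ {a c e} → b ≤ a → StrictColumn (suc a) c e → StrictColumn b (a ∷ c) e

data Chain (C : ℕ → Word → ℕ → Set) (b : ℕ) : List Word → ℕ → Set where
  []  : Chain C b [] b
  _∷_ : ∀ {c e cs e′} → C b c e → Chain C e cs e′ → Chain C b (c ∷ cs) e′

column-≥ : ∀ {b c e a} → StrictColumn b c e → a ∈ c → b ≤ a
column-≥ (bottom b≤e)     (here refl) = b≤e
column-≥ (above b≤a _)    (here refl) = b≤a
column-≥ (above b≤a col)  (there a∈c) = <⇒≤ (≤-<-trans b≤a (column-≥ col a∈c))

bound≤bottom : ∀ {b c e} → StrictColumn b c e → b ≤ e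
bound≤bottom (bottom b≤e)    = b≤e
bound≤bottom (above b≤a col) = <⇒≤ (≤-<-trans b≤a (bound≤bottom col))

column-≤ : ∀ {b c e a} → StrictColumn b c e → a ∈ c → a ≤ e
column-≤ (bottom _)    (here refl) = ≤-refl
column-≤ (above _ col) (here refl) = <⇒≤ (bound≤bottom col)
column-≤ (above _ col) (there a∈c) = column-≤ col a∈c

chain-≥ : ∀ {b cs e a} → Chain StrictColumn b cs e → a ∈ reading cs → b ≤ a
chain-≥ (_∷_ {c} col chain) a∈ with ∈-++⁻ (reverse c) a∈
... | inj₁ a∈c    = column-≥ col (reverse⁻ a∈c)
... | inj₂ a∈rest = ≤-trans (bound≤bottom col) (chain-≥ chain a∈rest)

data Column (b : ℕ) : Word → ℕ → Set where
  column : ∀ {a} c {e} → b ≤ a → last (a ∷ c) ≡ just e → Column b (a ∷ c) e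

column-++-[_] : ∀ {b c e} x → Column b c e → Column b (c ++ [ x ]) x
column-++-[_] x (column c b≤a _) = column (c ++ [ x ]) b≤a (last-++-[_] (_ ∷ c) x)

column-strict : ∀ {b c e} → Column b c e → Linked _<_ c → StrictColumn b c e
column-strict (column []      b≤a refl) [-]        = bottom b≤a
column-strict (column (_ ∷ c) b≤a last≡) (a<a′ ∷ l) = above b≤a (column-strict (column c a<a′ last≡) l)

chain-++-[_] : ∀ {C b cs e c e′} → Chain C b cs e → C e c e′ → Chain C b (cs ++ [ c ]) e′
chain-++-[_] []            col′ = col′ ∷ []
chain-++-[_] (col ∷ chain) col′ = col ∷ chain-++-[_] chain col′

chain-strict : ∀ {b cs e} → Chain Column b cs e → All (Linked _<_) cs → Chain StrictColumn b cs e
chain-strict []            []       = []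
chain-strict (col ∷ chain) (l ∷ ls) = column-strict col l ∷ chain-strict chain ls

-- The top entry of a column lies in the row of the bottom entry of the previous column,
-- to its right, hence is at least that entry.
Placed : List Word × Word → Set
Placed (cl , op) = ∃₂ λ e e′ → Chain Column 1 cl e × Column e op e′

placeRest-placed : ∀ {cl op e e′} ys → Chain Column 1 cl e → Column e op e′ →
                   Linked _≤_ (e′ ∷ ys) → Placed (placeRest cl op ys)
placeRest-placed []       chain col _           = _ , _ , chain , col
placeRest-placed (y ∷ ys) chain col (e′≤y ∷ l) =
  placeRest-placed ys (chain-++-[_] chain col) (column [] e′≤y refl) l

placeRows-placed : ∀ st rows → Placed st → All NonEmpty rows → All (Linked _≤_) rows →
                   Placed (foldl placeRow st rows)
placeRows-placed st [] placed _ _ = placed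
placeRows-placed (cl , op) ((x ∷ xs) ∷ rows) (_ , _ , chain , col) (nonEmpty ∷ nes) (l ∷ ls) =
  placeRows-placed _ rows (placeRest-placed xs chain (column-++-[_] x col) l) nes ls

tableau-chain : ∀ {rows} → QuasiRibbonTableau rows →
  ∃₂ λ cs e → Chain StrictColumn 1 cs e × reading cs ≡ columnReading rows
tableau-chain {[]} _ = [] , 1 , [] , refl
tableau-chain {rows@((x ∷ xs) ∷ rows′)}
  record { rowsNonEmpty = _ ∷ nes ; positive = (1≤x ∷ _) ∷ _ ; rowsWeak = l ∷ ls ; colsStrict = strict }
  with foldl placeRow ([] , []) rows
     | placeRows-placed _ rows′ (placeRest-placed xs [] (column [] 1≤x refl) l) nes ls
... | cl , op | _ , e′ , chain , col =
  cl ++ [ op ] , e′ , chain-strict (chain-++-[_] chain col) strict , refl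

-- Highest weight quasi-ribbon words

run : ℕ → ℕ → Word
run b zero    = [ b ]
run b (suc k) = b ∷ run (suc b) k

runs : ℕ → List ℕ → List Word
runs b []       = []
runs b (k ∷ ks) = run b k ∷ runs (b + k) ks

column-run : ∀ {b c e} → StrictColumn b c e →
  (∀ {i} → b ≤ i → suc i ∈ c → i ∈ c ⊎ e ≤ i) →
  ∃[ k ] (c ≡ run b k × e ≡ b + k)
column-run {b} (bottom b≤e) closed with m≤n⇒m<n∨m≡n b≤e
... | inj₂ refl = 0 , refl , sym (+-identityʳ b)
... | inj₁ (s≤s b≤i) with closed b≤i (here refl)
...   | inj₁ (here i≡si) = ⊥-elim (<⇒≢ (n<1+n _) i≡si)
...   | inj₂ si≤i        = ⊥-elim (1+n≰n si≤i)
column-run {b} (above {a} {c} {e} b≤a col) closed with column-run col closed′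
  where
  closed′ : ∀ {i} → suc a ≤ i → suc i ∈ c → i ∈ c ⊎ e ≤ i
  closed′ a<i si∈c with closed (≤-trans b≤a (<⇒≤ a<i)) (there si∈c)
  ... | inj₁ (here refl)  = ⊥-elim (1+n≰n a<i)
  ... | inj₁ (there i∈c)  = inj₁ i∈c
  ... | inj₂ e≤i          = inj₂ e≤i
... | k , refl , refl with m≤n⇒m<n∨m≡n b≤a
...   | inj₂ refl = suc k , refl , sym (+-suc b k)
...   | inj₁ (s≤s b≤j) with closed b≤j (here refl)
...     | inj₁ (here j≡a)   = ⊥-elim (<⇒≢ (n<1+n _) j≡a)
...     | inj₁ (there j∈c)  = ⊥-elim (1+n≰n (≤-trans (n≤1+n _) (column-≥ col j∈c)))
...     | inj₂ e≤j          = ⊥-elim (1+n≰n (≤-trans (n≤1+n _) (≤-trans (bound≤bottom col) e≤j)))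

highest-chain-runs : ∀ {b cs e} → Chain StrictColumn b cs e → InversionsFrom b (reading cs) →
  ∃[ ks ] cs ≡ runs b ks
highest-chain-runs [] _ = [] , refl
highest-chain-runs {b} (_∷_ {c} {e} {cs} col chain) inverted
  with column-run col (λ b≤i si∈c → predecessor (inverted b≤i (∈-++⁺ˡ (reverse⁺ si∈c))))
  where
  predecessor : ∀ {i} → Inversion i (reading (c ∷ cs)) → i ∈ c ⊎ e ≤ i
  predecessor inv with ∈-++⁻ (reverse c) (inversion⇒∈ inv)
  ... | inj₁ i∈c    = inj₁ (reverse⁻ i∈c)
  ... | inj₂ i∈rest = inj₂ (chain-≥ chain i∈rest)
... | k , refl , refl with highest-chain-runs chain inverted′
  where
  inverted′ : InversionsFrom (b + k) (reading cs)
  inverted′ e≤i si∈rest =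
    inversion-++⁻ (reverse c) (λ si∈c → 1+n≰n (≤-trans (column-≤ col (reverse⁻ si∈c)) e≤i))
      (inverted (≤-trans (m≤m+n b k) e≤i) (∈-++⁺ʳ (reverse c) si∈rest))
...   | ks , refl = k ∷ ks , refl

descentCode : List ℕ → List Bool
descentCode []       = []
descentCode (k ∷ ks) = replicate k true ++ false ∷ descentCode ks

descents-run : ∀ b k y → descents (reverse (run b k) ++ y) ≡ replicate k true ++ descents (b ∷ y)
descents-run b k y rewrite sym (ʳ++-defn (run b k) {y}) = go b k y
  where
  go : ∀ b k y → descents (run b k ʳ++ y) ≡ replicate k true ++ descents (b ∷ y)
  go b zero    y = refl
  go b (suc k) y rewrite go (suc b) k (b ∷ y) | n<ᵇ1+n b = replicate-++-∷ k true (descents (b ∷ y))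

descentAt-≥ : ∀ {b w} → (∀ {a} → a ∈ w → b ≤ a) → descentAt b w ≡ false
descentAt-≥ {w = []}    _   = refl
descentAt-≥ {b} {d ∷ _} b≤ with d <ᵇ b | <ᵇ-reflects-< d b
... | false | _        = refl
... | true  | ofʸ d<b  = ⊥-elim (<⇒≱ d<b (b≤ (here refl)))

run-≥ : ∀ {b k a} → a ∈ run b k → b ≤ a
run-≥ {k = zero}  (here refl) = ≤-refl
run-≥ {k = suc k} (here refl) = ≤-refl
run-≥ {k = suc k} (there a∈)  = <⇒≤ (run-≥ {k = k} a∈)

runs-≥ : ∀ {b} ks {a} → a ∈ reading (runs b ks) → b ≤ a
runs-≥ {b} (k ∷ ks) a∈ with ∈-++⁻ (reverse (run b k)) a∈
... | inj₁ a∈run  = run-≥ {k = k} (reverse⁻ a∈run)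
... | inj₂ a∈rest = ≤-trans (m≤m+n b k) (runs-≥ ks a∈rest)

descents-runs : ∀ b ks → descents (reading (runs b ks)) ≡ descentCode ks
descents-runs b []       = refl
descents-runs b (k ∷ ks) rewrite descents-run b k (reading (runs (b + k) ks))
  | descentAt-≥ {b} (≤-trans (m≤m+n b k) ∘ runs-≥ ks) | descents-runs (b + k) ks = refl

descentCode-injective : ∀ ks ks′ → descentCode ks ≡ descentCode ks′ → ks ≡ ks′
descentCode-injective []           []             _  = refl
descentCode-injective []           (zero  ∷ _)    ()
descentCode-injective []           (suc _ ∷ _)    ()
descentCode-injective (zero  ∷ _)  []             ()
descentCode-injective (suc _ ∷ _)  []             ()
descentCode-injective (zero ∷ ks)  (zero ∷ ks′)   eq =
  cong (0 ∷_) (descentCode-injective ks ks′ (∷-injectiveʳ eq))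
descentCode-injective (zero ∷ _)   (suc _ ∷ _)    ()
descentCode-injective (suc _ ∷ _)  (zero ∷ _)     ()
descentCode-injective (suc k ∷ ks) (suc k′ ∷ ks′) eq
  with descentCode-injective (k ∷ ks) (k′ ∷ ks′) (∷-injectiveʳ eq)
... | refl = refl

highest-quasiRibbon-runs : ∀ {n h} → InAlph n h → Highest n h → QuasiRibbonWord h →
  ∃[ ks ] h ≡ reading (runs 1 ks)
highest-quasiRibbon-runs h∈ highest (rows , T , refl) with tableau-chain T
... | cs , _ , chain , eq
  with highest-chain-runs chain (subst (InversionsFrom 1) (sym eq) (highest-inversions h∈ highest))
...   | ks , refl = ks , sym eq

highest-quasiRibbon-unique : ∀ {n h h′} →
  InAlph n h → Highest n h → QuasiRibbonWord h →
  InAlph n h′ → Highest n h′ → QuasiRibbonWord h′ →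
  descents h ≡ descents h′ → h ≡ h′
highest-quasiRibbon-unique h∈ highest ribbon h′∈ highest′ ribbon′ desc
  with highest-quasiRibbon-runs h∈ highest ribbon | highest-quasiRibbon-runs h′∈ highest′ ribbon′
... | ks , refl | ks′ , refl
  with descentCode-injective ks ks′ (trans (sym (descents-runs 1 ks)) (trans desc (descents-runs 1 ks′)))
...   | refl = refl

proposition8p8 : (n : ℕ) (u v : Word) → InAlph n u → InAlph n v →
    (∀ w → QuasiConn n u w → QuasiRibbonWord w) →
    (∀ w → QuasiConn n v w → QuasiRibbonWord w) →
    CrystalConn n u v → QuasiConn n u v
proposition8p8 n u v u∈ v∈ ribbonᵤ ribbonᵥ u~v
  with reach-highest u∈ (<-wellFounded (sum u)) | reach-highest v∈ (<-wellFounded (sum v))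
... | hᵤ , u~hᵤ , hᵤ∈ , descᵤ , highestᵤ | hᵥ , v~hᵥ , hᵥ∈ , descᵥ , highestᵥ
  with highest-quasiRibbon-unique hᵤ∈ highestᵤ (ribbonᵤ hᵤ u~hᵤ) hᵥ∈ highestᵥ (ribbonᵥ hᵥ v~hᵥ)
         (trans descᵤ (trans (crystal-descents u~v) (sym descᵥ)))
...   | refl = transitive _ u~hᵤ (symmetric _ v~hᵥ)
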